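{- Let $n$ and $k$ be positive integers. Then $$(n!!)^{k}-n^k=(k!!)^{n}-k^n$$ holds if and only if $k=n$ or $(k,n)\in\{(1,2),(2,1),(1,3),(3,1),(2,3),(3,2)\}$.
   Context: For a positive integer $m$, the double factorial $m!!$ is the product of all positive integers $\le m$ having the same parity as $m$, i.e. $m!!=m(m-2)(m-4)\cdots$, ending in $1$ if $m$ is odd and in $2$ if $m$ is even. -}

module Defs where

open import Data.Nat using (ℕ; zero; suc; _*_)

_!! : ℕ → ℕ
zero !! = 1
suc zero !! = 1
suc (suc m) !! = suc (suc m) * (m !!)

{-# OPTIONS --safe #-}
module Submission where

-- For 3 ≤ k < n one has 3 (k!!)^n ≤ 2 (n!!)^k. When n = k + 1 this goes by induction
-- k ↦ k + 2: the step combines the Wallis-type bound (k+2) (k!!)² ≤ 2 ((k+1)!!)²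
-- and Bernoulli's 2 x^x ≤ (x+1)^x. From n to n + 2 one multiplies by (k!!)² ≤ k^k ≤ (n+2)^k,
-- and n = k + 2 uses 3 k^k ≤ (k+2)^k. As (n!!)^k ≥ (2n)^k > 3 n^k, this margin of 3/2
-- absorbs n^k, so (k!!)^n + n^k < (n!!)^k when 4 ≤ k < n. For k ≤ 3 we have k!! = k and
-- the equation says (n!!)^k = n^k, which needs n!! = n. Hence a solution with k ≠ n has
-- k, n ≤ 3, and all those pairs are solutions since m!! = m for m ≤ 3.

open import Defs
open import Data.Nat
open import Data.Nat.Properties
open import Data.Nat.Tactic.RingSolver using (solve-∀)
open import Data.Integer as ℤ using (+_; _-_)
import Data.Integer.Properties as ℤ
import Data.Integer.Tactic.RingSolver as ℤ
open import Data.Product using (_×_; _,_)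
open import Data.Sum using (_⊎_; inj₁; inj₂)
open import Function using (_∘_)
open import Function.Bundles using (_⇔_; mk⇔)
open import Relation.Binary.Definitions using (tri<; tri≈; tri>)
open import Relation.Binary.PropositionalEquality using (_≡_; refl; sym; cong; subst; module ≡-Reasoning)
open import Relation.Nullary using (yes; no)

^-distribʳ-* : ∀ m n o → (m * n) ^ o ≡ m ^ o * n ^ o
^-distribʳ-* m n zero    = refl
^-distribʳ-* m n (suc o) = begin
  m * n * (m * n) ^ o       ≡⟨ cong (m * n *_) (^-distribʳ-* m n o) ⟩
  m * n * (m ^ o * n ^ o)   ≡⟨ interchange m n (m ^ o) (n ^ o) ⟩
  m * m ^ o * (n * n ^ o)   ∎
  where
  open ≡-Reasoning
  interchange : ∀ a b c d → a * b * (c * d) ≡ a * c * (b * d)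
  interchange = solve-∀

!!-nonZero : ∀ m → NonZero (m !!)
!!-nonZero zero          = _
!!-nonZero (suc zero)    = _
!!-nonZero (suc (suc m)) = m*n≢0 (suc (suc m)) (m !!) {{_}} {{ !!-nonZero m }}

m≤m!! : ∀ m → m ≤ m !!
m≤m!! zero          = z≤n
m≤m!! (suc zero)    = ≤-refl
m≤m!! (suc (suc m)) = m≤m*n (suc (suc m)) (m !!) {{ !!-nonZero m }}

2*n≤n!! : ∀ {n} → 4 ≤ n → 2 * n ≤ n !!
2*n≤n!! {suc (suc n)} (s≤s (s≤s 2≤n)) = begin
  2 * suc (suc n)      ≡⟨ *-comm 2 (suc (suc n)) ⟩
  suc (suc n) * 2      ≤⟨ *-monoʳ-≤ (suc (suc n)) (≤-trans 2≤n (m≤m!! n)) ⟩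
  suc (suc n) * n !!   ∎
  where open ≤-Reasoning

m!!*m!!≤m^m : ∀ m → m !! * m !! ≤ m ^ m
m!!*m!!≤m^m zero          = ≤-refl
m!!*m!!≤m^m (suc zero)    = ≤-refl
m!!*m!!≤m^m (suc (suc m)) = begin
  M * m !! * (M * m !!)    ≡⟨ interchange M (m !!) ⟩
  M * (M * (m !! * m !!))  ≤⟨ *-monoʳ-≤ M (*-monoʳ-≤ M (m!!*m!!≤m^m m)) ⟩
  M * (M * m ^ m)          ≤⟨ *-monoʳ-≤ M (*-monoʳ-≤ M (^-monoˡ-≤ m (m≤n+m m 2))) ⟩
  M * (M * M ^ m)          ∎
  where
  open ≤-Reasoning
  M = suc (suc m)
  interchange : ∀ x a → x * a * (x * a) ≡ x * (x * (a * a))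
  interchange = solve-∀

bernoulli : ∀ x y j → x ^ j * (x + j * y) ≤ x * (x + y) ^ j
bernoulli x y zero    = ≤-reflexive (base x y)
  where
  base : ∀ x y → 1 * (x + 0 * y) ≡ x * 1
  base = solve-∀
bernoulli x y (suc j) = begin
  x * x ^ j * (x + suc j * y)                       ≤⟨ m≤m+n _ (x ^ j * (j * y * y)) ⟩
  x * x ^ j * (x + suc j * y) + x ^ j * (j * y * y) ≡⟨ expand x y j (x ^ j) ⟩
  (x + y) * (x ^ j * (x + j * y))                   ≤⟨ *-monoʳ-≤ (x + y) (bernoulli x y j) ⟩
  (x + y) * (x * (x + y) ^ j)                       ≡⟨ swap (x + y) x ((x + y) ^ j) ⟩
  x * ((x + y) * (x + y) ^ j)                       ∎
  where
  open ≤-Reasoning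
  expand : ∀ x y j p → x * p * (x + suc j * y) + p * (j * y * y) ≡ (x + y) * (p * (x + j * y))
  expand = solve-∀
  swap : ∀ a b c → a * (b * c) ≡ b * (a * c)
  swap = solve-∀

[1+y]*x^x≤[y+x]^x : ∀ x y .{{_ : NonZero x}} → suc y * x ^ x ≤ (y + x) ^ x
[1+y]*x^x≤[y+x]^x x y = *-cancelˡ-≤ x (begin
  x * (suc y * x ^ x)   ≡⟨ regroup x y (x ^ x) ⟩
  x ^ x * (x + x * y)   ≤⟨ bernoulli x y x ⟩
  x * (x + y) ^ x       ≡⟨ cong (λ z → x * z ^ x) (+-comm x y) ⟩
  x * (y + x) ^ x       ∎)
  where
  open ≤-Reasoning
  regroup : ∀ x y p → x * (suc y * p) ≡ p * (x + x * y)
  regroup = solve-∀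

wallis : ∀ k → (2 + k) * (k !! * k !!) ≤ 2 * (suc k !! * suc k !!)
wallis zero          = ≤-refl
wallis (suc zero)    = ≤ᵇ⇒≤ 3 8 _
wallis (suc (suc k)) = begin
  (4 + k) * ((2 + k) * a * ((2 + k) * a))    ≡⟨ regroup (2 + k) a ⟩
  (4 + k) * (2 + k) * ((2 + k) * (a * a))    ≤⟨ *-monoʳ-≤ ((4 + k) * (2 + k)) (wallis k) ⟩
  (4 + k) * (2 + k) * (2 * (b * b))          ≤⟨ *-monoˡ-≤ (2 * (b * b)) (m≤m+n ((4 + k) * (2 + k)) 1) ⟩
  ((4 + k) * (2 + k) + 1) * (2 * (b * b))    ≡⟨ square k b ⟩
  2 * ((3 + k) * b * ((3 + k) * b))          ∎
  where
  open ≤-Reasoning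
  a = k !!
  b = suc k !!
  regroup : ∀ x a → (2 + x) * (x * a * (x * a)) ≡ (2 + x) * x * (x * (a * a))
  regroup = solve-∀
  square : ∀ k b → ((4 + k) * (2 + k) + 1) * (2 * (b * b)) ≡ 2 * ((3 + k) * b * ((3 + k) * b))
  square = solve-∀

consecutive-!!-powers-step : ∀ k → 3 * (k !!) ^ suc k ≤ 2 * (suc k !!) ^ k →
                             3 * ((2 + k) !!) ^ (3 + k) ≤ 2 * ((3 + k) !!) ^ (2 + k)
consecutive-!!-powers-step k hyp = begin
  3 * (x * a) ^ suc x                      ≡⟨ cong (3 *_) (^-distribʳ-* x a (suc x)) ⟩
  3 * (x * x ^ x * (a * (a * a ^ suc k)))  ≡⟨ regroupˡ x a (x ^ x) (a ^ suc k) ⟩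
  3 * a ^ suc k * (x * (a * a) * x ^ x)    ≤⟨ *-mono-≤ hyp (*-monoˡ-≤ (x ^ x) (wallis k)) ⟩
  2 * b ^ k * (2 * (b * b) * x ^ x)        ≡⟨ regroupʳ b (b ^ k) (x ^ x) ⟩
  2 * (b ^ x * (2 * x ^ x))                ≤⟨ *-monoʳ-≤ 2 (*-monoʳ-≤ (b ^ x) ([1+y]*x^x≤[y+x]^x x 1)) ⟩
  2 * (b ^ x * (suc x) ^ x)                ≡⟨ cong (2 *_) (*-comm (b ^ x) (suc x ^ x)) ⟩
  2 * (suc x ^ x * b ^ x)                  ≡⟨ cong (2 *_) (^-distribʳ-* (suc x) b x) ⟨
  2 * (suc x * b) ^ x                      ∎
  where
  open ≤-Reasoning
  x = 2 + k
  a = k !!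
  b = suc k !!
  regroupˡ : ∀ x a X A → 3 * (x * X * (a * (a * A))) ≡ 3 * A * (x * (a * a) * X)
  regroupˡ = solve-∀
  regroupʳ : ∀ b B X → 2 * B * (2 * (b * b) * X) ≡ 2 * (b * (b * B) * (2 * X))
  regroupʳ = solve-∀

consecutive-!!-powers : ∀ {k} → 3 ≤ k → 3 * (k !!) ^ suc k ≤ 2 * (suc k !!) ^ k
consecutive-!!-powers {1} (s≤s ())
consecutive-!!-powers {2} (s≤s (s≤s ()))
consecutive-!!-powers {3} _ = ≤ᵇ⇒≤ _ _ _
consecutive-!!-powers {4} _ = ≤ᵇ⇒≤ _ _ _
consecutive-!!-powers {suc (suc k@(suc (suc (suc _))))} _ =
  consecutive-!!-powers-step k (consecutive-!!-powers {k} (s≤s (s≤s (s≤s z≤n))))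

!!-powers-step : ∀ {u v w z k n} →
                 u * (k !!) ^ n ≤ v * (n !!) ^ k → w * (k !! * k !!) ≤ z * (2 + n) ^ k →
                 u * w * (k !!) ^ (2 + n) ≤ v * z * ((2 + n) !!) ^ k
!!-powers-step {u} {v} {w} {z} {k} {n} hypₙ hyp₂ = begin
  u * w * (a * (a * a ^ n))          ≡⟨ regroupˡ u w a (a ^ n) ⟩
  u * a ^ n * (w * (a * a))          ≤⟨ *-mono-≤ hypₙ hyp₂ ⟩
  v * (n !!) ^ k * (z * (2 + n) ^ k) ≡⟨ regroupʳ v z ((n !!) ^ k) ((2 + n) ^ k) ⟩
  v * z * ((2 + n) ^ k * (n !!) ^ k) ≡⟨ cong (v * z *_) (^-distribʳ-* (2 + n) (n !!) k) ⟨
  v * z * ((2 + n) * n !!) ^ k       ∎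
  where
  open ≤-Reasoning
  a = k !!
  regroupˡ : ∀ u w a A → u * w * (a * (a * A)) ≡ u * A * (w * (a * a))
  regroupˡ = solve-∀
  regroupʳ : ∀ v z N X → v * N * (z * X) ≡ v * z * (X * N)
  regroupʳ = solve-∀

!!-powers : ∀ {k n} → 3 ≤ k → k < n → 3 * (k !!) ^ n ≤ 2 * (n !!) ^ k
!!-powers {k} {n} 3≤k k<n =
  subst (λ m → 3 * (k !!) ^ m ≤ 2 * (m !!) ^ k) (m∸n+n≡m k<n) (beyond (n ∸ suc k))
  where
  instance
    k≢0 : NonZero k
    k≢0 = >-nonZero (≤-trans (s≤s z≤n) 3≤k)
  beyond : ∀ d → 3 * (k !!) ^ (d + suc k) ≤ 2 * ((d + suc k) !!) ^ k
  beyond zero          = consecutive-!!-powers 3≤k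
  beyond (suc zero)    = !!-powers-step {1} {1} {3} {2} {k} {k} ≤-refl (begin
    3 * (k !! * k !!)  ≤⟨ *-monoʳ-≤ 3 (m!!*m!!≤m^m k) ⟩
    3 * k ^ k          ≤⟨ [1+y]*x^x≤[y+x]^x k 2 ⟩
    (2 + k) ^ k        ≤⟨ m≤m+n ((2 + k) ^ k) _ ⟩
    2 * (2 + k) ^ k    ∎)
    where open ≤-Reasoning
  beyond (suc (suc d)) = !!-powers-step {3} {2} {1} {1} {k} {d + suc k} (beyond d) (begin
    1 * (k !! * k !!)          ≤⟨ *-monoʳ-≤ 1 (m!!*m!!≤m^m k) ⟩
    1 * k ^ k                  ≤⟨ *-monoʳ-≤ 1 (^-monoˡ-≤ k (≤-trans (m≤n+m k d) (m≤n+m (d + k) 3))) ⟩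
    1 * (3 + (d + k)) ^ k      ≡⟨ cong (λ m → 1 * (2 + m) ^ k) (+-suc d k) ⟨
    1 * (2 + (d + suc k)) ^ k  ∎)
    where open ≤-Reasoning

n<n!! : ∀ {n} → 4 ≤ n → n < n !!
n<n!! {suc (suc n)} (s≤s (s≤s 2≤n)) = m<m*n (suc (suc n)) (n !!) (≤-trans 2≤n (m≤m!! n))

3*n^k<[n!!]^k : ∀ {k n} → 2 ≤ k → 4 ≤ n → 3 * n ^ k < (n !!) ^ k
3*n^k<[n!!]^k {k} {n} 2≤k 4≤n = begin-strict
  3 * n ^ k         <⟨ *-monoˡ-< (n ^ k) {{m^n≢0 n k {{n≢0}}}} (n<1+n 3) ⟩
  2 ^ 2 * n ^ k     ≤⟨ *-monoˡ-≤ (n ^ k) (^-monoʳ-≤ 2 2≤k) ⟩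
  2 ^ k * n ^ k     ≡⟨ ^-distribʳ-* 2 n k ⟨
  (2 * n) ^ k       ≤⟨ ^-monoˡ-≤ k (2*n≤n!! 4≤n) ⟩
  (n !!) ^ k        ∎
  where
  open ≤-Reasoning
  n≢0 : NonZero n
  n≢0 = >-nonZero (≤-trans (s≤s z≤n) 4≤n)

3*a≤2*c∧3*b<c⇒a+b<c : ∀ {a b c} → 3 * a ≤ 2 * c → 3 * b < c → a + b < c
3*a≤2*c∧3*b<c⇒a+b<c {a} {b} {c} 3a≤2c 3b<c = *-cancelˡ-< 3 (a + b) c (begin-strict
  3 * (a + b)    ≡⟨ *-distribˡ-+ 3 a b ⟩
  3 * a + 3 * b  <⟨ +-mono-≤-< 3a≤2c 3b<c ⟩
  2 * c + c      ≡⟨ collect c ⟩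
  3 * c          ∎)
  where
  open ≤-Reasoning
  collect : ∀ c → 2 * c + c ≡ 3 * c
  collect = solve-∀

!!-small : ∀ {k} → 1 ≤ k → k ≤ 3 → k !! ≡ k
!!-small {1} _ _ = refl
!!-small {2} _ _ = refl
!!-small {3} _ _ = refl
!!-small {suc (suc (suc (suc _)))} _ (s≤s (s≤s (s≤s ())))

[k!!]^n+n^k<[n!!]^k+k^n : ∀ {k n} → 1 ≤ k → k < n → 4 ≤ n → (k !!) ^ n + n ^ k < (n !!) ^ k + k ^ n
[k!!]^n+n^k<[n!!]^k+k^n {k} {n} 1≤k k<n 4≤n with k ≤? 3
... | yes k≤3 = begin-strict
  (k !!) ^ n + n ^ k   ≡⟨ cong (λ m → m ^ n + n ^ k) (!!-small 1≤k k≤3) ⟩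
  k ^ n + n ^ k        <⟨ +-monoʳ-< (k ^ n) (^-monoˡ-< k {{>-nonZero 1≤k}} (n<n!! 4≤n)) ⟩
  k ^ n + (n !!) ^ k   ≡⟨ +-comm (k ^ n) ((n !!) ^ k) ⟩
  (n !!) ^ k + k ^ n   ∎
  where open ≤-Reasoning
... | no k≰3 = <-≤-trans
  (3*a≤2*c∧3*b<c⇒a+b<c {(k !!) ^ n} {n ^ k} (!!-powers 3≤k k<n) (3*n^k<[n!!]^k 2≤k 4≤n))
  (m≤m+n ((n !!) ^ k) (k ^ n))
  where
  3≤k : 3 ≤ k
  3≤k = <⇒≤ (≰⇒> k≰3)
  2≤k : 2 ≤ k
  2≤k = ≤-trans (n≤1+n 2) 3≤k

Balanced : ℕ → ℕ → Set
Balanced n k = (n !!) ^ k + k ^ n ≡ (k !!) ^ n + n ^ k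

balanced⇒≤3 : ∀ {k n} → 1 ≤ k → k < n → Balanced n k → n ≤ 3
balanced⇒≤3 1≤k k<n eq = ≮⇒≥ λ 3<n → <-irrefl (sym eq) ([k!!]^n+n^k<[n!!]^k+k^n 1≤k k<n 3<n)

-≡-⇒+≡+ : ∀ {a b c d} → + a - + b ≡ + c - + d → a + d ≡ c + b
-≡-⇒+≡+ {a} {b} {c} {d} eq = ℤ.+-injective (begin
  + a ℤ.+ + d                     ≡⟨ add-back (+ a) (+ b) (+ d) ⟩
  (+ a - + b) ℤ.+ (+ b ℤ.+ + d)   ≡⟨ cong (ℤ._+ (+ b ℤ.+ + d)) eq ⟩
  (+ c - + d) ℤ.+ (+ b ℤ.+ + d)   ≡⟨ cancel (+ c) (+ d) (+ b) ⟩
  + c ℤ.+ + b                     ∎)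
  where
  open ≡-Reasoning
  add-back : ∀ i j l → i ℤ.+ l ≡ (i - j) ℤ.+ (j ℤ.+ l)
  add-back = ℤ.solve-∀
  cancel : ∀ i j l → (i - j) ℤ.+ (l ℤ.+ j) ≡ i ℤ.+ l
  cancel = ℤ.solve-∀

Solution : ℕ → ℕ → Set
Solution n k = k ≡ n
             ⊎ (k ≡ 1 × n ≡ 2) ⊎ (k ≡ 2 × n ≡ 1)
             ⊎ (k ≡ 1 × n ≡ 3) ⊎ (k ≡ 3 × n ≡ 1)
             ⊎ (k ≡ 2 × n ≡ 3) ⊎ (k ≡ 3 × n ≡ 2)

small-solution : ∀ {n k} → 1 ≤ n → 1 ≤ k → n ≤ 3 → k ≤ 3 → Solution n k
small-solution {1} {1} _ _ _ _ = inj₁ refl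
small-solution {2} {2} _ _ _ _ = inj₁ refl
small-solution {3} {3} _ _ _ _ = inj₁ refl
small-solution {2} {1} _ _ _ _ = inj₂ (inj₁ (refl , refl))
small-solution {1} {2} _ _ _ _ = inj₂ (inj₂ (inj₁ (refl , refl)))
small-solution {3} {1} _ _ _ _ = inj₂ (inj₂ (inj₂ (inj₁ (refl , refl))))
small-solution {1} {3} _ _ _ _ = inj₂ (inj₂ (inj₂ (inj₂ (inj₁ (refl , refl)))))
small-solution {3} {2} _ _ _ _ = inj₂ (inj₂ (inj₂ (inj₂ (inj₂ (inj₁ (refl , refl))))))
small-solution {2} {3} _ _ _ _ = inj₂ (inj₂ (inj₂ (inj₂ (inj₂ (inj₂ (refl , refl))))))
small-solution {suc (suc (suc (suc _)))} _ _ (s≤s (s≤s (s≤s ()))) _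
small-solution {k = suc (suc (suc (suc _)))} _ _ _ (s≤s (s≤s (s≤s ())))

balanced⇒solution : ∀ {n k} → 1 ≤ n → 1 ≤ k → Balanced n k → Solution n k
balanced⇒solution {n} {k} 1≤n 1≤k eq with <-cmp k n
... | tri≈ _ k≡n _ = inj₁ k≡n
... | tri< k<n _ _ = small-solution 1≤n 1≤k n≤3 (≤-trans (<⇒≤ k<n) n≤3)
  where n≤3 = balanced⇒≤3 1≤k k<n eq
... | tri> _ _ n<k = small-solution 1≤n 1≤k (≤-trans (<⇒≤ n<k) k≤3) k≤3
  where k≤3 = balanced⇒≤3 1≤n n<k (sym eq)

solution⇒equation : ∀ {n k} → Solution n k → + ((n !!) ^ k) - + (n ^ k) ≡ + ((k !!) ^ n) - + (k ^ n)
solution⇒equation (inj₁ refl)                                                = refl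
solution⇒equation (inj₂ (inj₁ (refl , refl)))                                = refl
solution⇒equation (inj₂ (inj₂ (inj₁ (refl , refl))))                         = refl
solution⇒equation (inj₂ (inj₂ (inj₂ (inj₁ (refl , refl)))))                  = refl
solution⇒equation (inj₂ (inj₂ (inj₂ (inj₂ (inj₁ (refl , refl))))))           = refl
solution⇒equation (inj₂ (inj₂ (inj₂ (inj₂ (inj₂ (inj₁ (refl , refl)))))))    = refl
solution⇒equation (inj₂ (inj₂ (inj₂ (inj₂ (inj₂ (inj₂ (refl , refl)))))))    = refl

theorem1p1 : (n k : ℕ) → n ≥ 1 → k ≥ 1 →
    ((+ ((n !!) ^ k) - + (n ^ k) ≡ + ((k !!) ^ n) - + (k ^ n))
      ⇔
     (k ≡ n
      ⊎ (k ≡ 1 × n ≡ 2) ⊎ (k ≡ 2 × n ≡ 1)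
      ⊎ (k ≡ 1 × n ≡ 3) ⊎ (k ≡ 3 × n ≡ 1)
      ⊎ (k ≡ 2 × n ≡ 3) ⊎ (k ≡ 3 × n ≡ 2)))
theorem1p1 n k 1≤n 1≤k =
  mk⇔ (balanced⇒solution 1≤n 1≤k ∘ -≡-⇒+≡+ {(n !!) ^ k} {n ^ k} {(k !!) ^ n} {k ^ n})
      solution⇒equation
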